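{- Let $r\ge 1$ be an integer. If $A\subseteq\mathbb{F}_2^r\setminus\{0\}$ is a minimal $1$-saturating set, then either $A$ or $A\cup\{0\}$ is round.
   Context: $\mathbb{F}_2^r$ denotes the elementary abelian $2$-group of rank $r$. For $X\subseteq\mathbb{F}_2^r$, $2X:=\{x_1+x_2\colon x_1,x_2\in X\}$ (with $x_1=x_2$ allowed). A set $A\subseteq\mathbb{F}_2^r\setminus\{0\}$ is $1$-saturating if $A\cup 2A=\mathbb{F}_2^r$, and minimal $1$-saturating if moreover no proper subset of it is $1$-saturating. A set $A\subseteq\mathbb{F}_2^r$ is round if $2B\ne 2A$ for every proper subset $B\subsetneq A$. -}

module Defs where

open import Data.Bool using (Bool; true; false; _xor_; _∨_)
open import Data.Bool.Properties using () renaming (_≟_ to _≟B_)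
open import Data.Nat using (ℕ)
open import Data.Vec using (Vec; zipWith; replicate)
open import Data.Vec.Properties using (≡-dec)
open import Data.Product using (_×_; ∃; ∃-syntax; _,_)
open import Data.Sum using (_⊎_)
open import Relation.Nullary using (¬_; does)
open import Relation.Binary.PropositionalEquality using (_≡_)

F₂^ : ℕ → Set
F₂^ r = Vec Bool r

_⊕_ : ∀ {r} → F₂^ r → F₂^ r → F₂^ r
_⊕_ = zipWith _xor_

𝟘 : ∀ {r} → F₂^ r
𝟘 {r} = replicate r false

_≟V_ : ∀ {r} (x y : F₂^ r) → Relation.Nullary.Dec (x ≡ y)
_≟V_ = ≡-dec _≟B_

Subset : ℕ → Set
Subset r = F₂^ r → Bool

_∈_ : ∀ {r} → F₂^ r → Subset r → Set
x ∈ A = A x ≡ true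

_∉_ : ∀ {r} → F₂^ r → Subset r → Set
x ∉ A = ¬ (x ∈ A)

insert0 : ∀ {r} → Subset r → Subset r
insert0 A x = does (x ≟V 𝟘) ∨ A x

_⊆_ : ∀ {r} → Subset r → Subset r → Set
B ⊆ A = ∀ x → x ∈ B → x ∈ A

_⊊_ : ∀ {r} → Subset r → Subset r → Set
B ⊊ A = B ⊆ A × ∃[ x ] (x ∈ A × x ∉ B)

-- membership in the sumset 2X = {x₁ + x₂ : x₁, x₂ ∈ X} (x₁ = x₂ allowed)
_∈2_ : ∀ {r} → F₂^ r → Subset r → Set
y ∈2 X = ∃[ x₁ ] ∃[ x₂ ] (x₁ ∈ X × x₂ ∈ X × x₁ ⊕ x₂ ≡ y)

Same2 : ∀ {r} → Subset r → Subset r → Set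
Same2 B A = ∀ y → (y ∈2 B → y ∈2 A) × (y ∈2 A → y ∈2 B)

OneSaturating : ∀ {r} → Subset r → Set
OneSaturating {r} A = 𝟘 ∉ A × (∀ (y : F₂^ r) → y ∈ A ⊎ y ∈2 A)

MinimalOneSaturating : ∀ {r} → Subset r → Set
MinimalOneSaturating A = OneSaturating A × (∀ B → B ⊊ A → ¬ OneSaturating B)

Round : ∀ {r} → Subset r → Set
Round A = ∀ B → B ⊊ A → ¬ Same2 B A

module Submission where

-- Let A ⊆ F₂^r ∖ {0} be minimal 1-saturating; since F₂^r is
-- finite we may decide whether the sumset 2A is all of F₂^r.
--   * If 2A = F₂^r, then A is round: a proper subset B ⊊ A with 2B = 2A has
--     full sumset, hence is itself 1-saturating, contradicting minimality.
--   * Otherwise A ∪ {0} is round.  Saturation of A gives 2(A ∪ {0}) = F₂^r,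
--     so take B ⊊ A ∪ {0} with full sumset.  If 0 ∉ B then B ⊆ A and
--     2B ⊆ 2A ≠ F₂^r, impossible.  If 0 ∈ B then B ∖ {0} is a proper subset
--     of A, and it is 1-saturating: every nonzero y = x₁ + x₂ with x₁, x₂ ∈ B
--     either lies in B ∖ {0} (when one summand is 0) or in 2(B ∖ {0}), and
--     0 = x + x for any element x, which exists because r ≥ 1.
-- The file first proves decidability of quantifiers over F₂^r and of
-- sumset membership, then the small group laws used, facts about adding
-- and deleting 0, the two saturation criteria, the two roundness cases,
-- and finally the theorem as a case split.

open import Defs
open import Data.Nat using (ℕ; _≥_; zero; suc)
open import Data.Sum using (_⊎_; inj₁; inj₂)
open import Data.Bool using (true; false; not; _∧_)
open import Data.Bool.Properties using (xor-identityˡ; xor-identityʳ; xor-same)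
  renaming (_≟_ to _≟B_)
open import Data.Vec using ([]; _∷_; replicate)
open import Data.Vec.Properties
  using (zipWith-identityˡ; zipWith-identityʳ; zipWith-inverseˡ; map-id)
open import Data.Product using (∃-syntax; _,_; proj₁; proj₂)
open import Data.Empty using (⊥-elim)
open import Relation.Nullary using (¬_; Dec; yes; no; does)
open import Relation.Nullary.Decidable using (_×-dec_)
open import Relation.Binary.PropositionalEquality
  using (_≡_; refl; sym; trans; cong; subst)

∀-dec : ∀ n (P : F₂^ n → Set) → (∀ v → Dec (P v)) → Dec (∀ v → P v)
∀-dec zero P P? with P? []
... | yes p = yes λ { [] → p }
... | no ¬p = no λ all → ¬p (all [])
∀-dec (suc n) P P? with ∀-dec n (λ v → P (true ∷ v)) (λ v → P? (true ∷ v))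
                      | ∀-dec n (λ v → P (false ∷ v)) (λ v → P? (false ∷ v))
... | yes p | yes q = yes λ { (true ∷ v) → p v ; (false ∷ v) → q v }
... | no ¬p | _     = no λ all → ¬p (λ v → all (true ∷ v))
... | _     | no ¬q = no λ all → ¬q (λ v → all (false ∷ v))

∃-dec : ∀ n (P : F₂^ n → Set) → (∀ v → Dec (P v)) → Dec (∃[ v ] P v)
∃-dec zero P P? with P? []
... | yes p = yes ([] , p)
... | no ¬p = no λ { ([] , p) → ¬p p }
∃-dec (suc n) P P? with ∃-dec n (λ v → P (true ∷ v)) (λ v → P? (true ∷ v))
                      | ∃-dec n (λ v → P (false ∷ v)) (λ v → P? (false ∷ v))
... | yes (v , p) | _           = yes (true ∷ v , p)
... | no _        | yes (v , q) = yes (false ∷ v , q)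
... | no ¬p       | no ¬q       =
  no λ { (true ∷ v , p) → ¬p (v , p) ; (false ∷ v , q) → ¬q (v , q) }

∈2-dec : ∀ {r} (A : Subset r) y → Dec (y ∈2 A)
∈2-dec {r} A y = ∃-dec r _ λ x₁ → ∃-dec r _ λ x₂ →
  (A x₁ ≟B true) ×-dec ((A x₂ ≟B true) ×-dec ((x₁ ⊕ x₂) ≟V y))

full-sumset-dec : ∀ {r} (A : Subset r) → Dec (∀ y → y ∈2 A)
full-sumset-dec {r} A = ∀-dec r (λ y → y ∈2 A) (∈2-dec A)

⊕-identityˡ : ∀ {r} (x : F₂^ r) → 𝟘 ⊕ x ≡ x
⊕-identityˡ = zipWith-identityˡ xor-identityˡ

⊕-identityʳ : ∀ {r} (x : F₂^ r) → x ⊕ 𝟘 ≡ x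
⊕-identityʳ = zipWith-identityʳ xor-identityʳ

⊕-self : ∀ {r} (x : F₂^ r) → x ⊕ x ≡ 𝟘
⊕-self x = trans (cong (_⊕ x) (sym (map-id x))) (zipWith-inverseˡ xor-same x)

nonzero-element : ∀ r → r ≥ 1 → ∃[ e ] (¬ e ≡ 𝟘 {r})
nonzero-element (suc r) _ = true ∷ replicate r false , λ ()

∈2-mono : ∀ {r} {B A : Subset r} → B ⊆ A → ∀ {y} → y ∈2 B → y ∈2 A
∈2-mono B⊆A (x₁ , x₂ , x₁∈B , x₂∈B , sum) =
  x₁ , x₂ , B⊆A x₁ x₁∈B , B⊆A x₂ x₂∈B , sum

insert0-⊇ : ∀ {r} (A : Subset r) → A ⊆ insert0 A
insert0-⊇ A x x∈A with x ≟V 𝟘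
... | yes _ = refl
... | no _  = x∈A

insert0-∋0 : ∀ {r} (A : Subset r) → 𝟘 ∈ insert0 A
insert0-∋0 {r} A with 𝟘 {r} ≟V 𝟘
... | yes _  = refl
... | no x≢0 = ⊥-elim (x≢0 refl)

insert0-nonzero : ∀ {r} (A : Subset r) x → ¬ x ≡ 𝟘 → x ∈ insert0 A → x ∈ A
insert0-nonzero A x x≢0 x∈A₀ with x ≟V 𝟘
... | yes x≡0 = ⊥-elim (x≢0 x≡0)
... | no _    = x∈A₀

-- If A is 1-saturating then 2(A ∪ {0}) = A ∪ 2A = F₂^r.
insert0-full-sumset : ∀ {r} (A : Subset r) → OneSaturating A → ∀ y → y ∈2 insert0 A
insert0-full-sumset A (_ , sat) y with sat y
... | inj₁ y∈A = y , 𝟘 , insert0-⊇ A y y∈A , insert0-∋0 A , ⊕-identityʳ y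
... | inj₂ y∈2A = ∈2-mono (insert0-⊇ A) y∈2A

delete0 : ∀ {r} → Subset r → Subset r
delete0 B x = not (does (x ≟V 𝟘)) ∧ B x

delete0-⊆ : ∀ {r} (B : Subset r) x → x ∈ delete0 B → x ∈ B
delete0-⊆ B x x∈B′ with x ≟V 𝟘
... | no _ = x∈B′

delete0-∌0 : ∀ {r} (B : Subset r) → 𝟘 ∉ delete0 B
delete0-∌0 {r} B with 𝟘 {r} ≟V 𝟘
... | yes _  = λ ()
... | no 0≢0 = ⊥-elim (0≢0 refl)

delete0-nonzero : ∀ {r} (B : Subset r) x → ¬ x ≡ 𝟘 → x ∈ B → x ∈ delete0 B
delete0-nonzero B x x≢0 x∈B with x ≟V 𝟘
... | yes x≡0 = ⊥-elim (x≢0 x≡0)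
... | no _    = x∈B

saturating-of-full-sumset : ∀ {r} (B : Subset r) → 𝟘 ∉ B → (∀ y → y ∈2 B) →
                            OneSaturating B
saturating-of-full-sumset B 0∉B full = 0∉B , λ y → inj₂ (full y)

-- If every nonzero element is a sum of two elements of B and r ≥ 1, then
-- B ∖ {0} is 1-saturating: a sum with a zero summand is an element of
-- B ∖ {0}, and 0 = x + x for any element x of B ∖ {0}.
delete0-saturating : ∀ r → r ≥ 1 → (B : Subset r) →
                     (∀ y → ¬ y ≡ 𝟘 → y ∈2 B) → OneSaturating (delete0 B)
delete0-saturating r r≥1 B nonzero-sums = delete0-∌0 B , covered
  where
  covered-nonzero : ∀ y → ¬ y ≡ 𝟘 → y ∈ delete0 B ⊎ y ∈2 delete0 B
  covered-nonzero y y≢0 with nonzero-sums y y≢0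
  ... | x₁ , x₂ , x₁∈B , x₂∈B , sum with x₁ ≟V 𝟘 | x₂ ≟V 𝟘
  ... | yes x₁≡0 | _ = inj₁ (delete0-nonzero B y y≢0 (subst (_∈ B) y≡x₂ x₂∈B))
    where y≡x₂ = trans (sym (⊕-identityˡ x₂)) (trans (cong (_⊕ x₂) (sym x₁≡0)) sum)
  ... | no _ | yes x₂≡0 = inj₁ (delete0-nonzero B y y≢0 (subst (_∈ B) y≡x₁ x₁∈B))
    where y≡x₁ = trans (sym (⊕-identityʳ x₁)) (trans (cong (x₁ ⊕_) (sym x₂≡0)) sum)
  ... | no x₁≢0 | no x₂≢0 =
    inj₂ (x₁ , x₂ , delete0-nonzero B x₁ x₁≢0 x₁∈B , delete0-nonzero B x₂ x₂≢0 x₂∈B , sum)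

  some-element : ∃[ w ] (w ∈ delete0 B)
  some-element with nonzero-element r r≥1
  ... | e , e≢0 with covered-nonzero e e≢0
  ... | inj₁ e∈B′ = e , e∈B′
  ... | inj₂ (x₁ , _ , x₁∈B′ , _) = x₁ , x₁∈B′

  covered-by-cases : ∀ y → Dec (y ≡ 𝟘) → y ∈ delete0 B ⊎ y ∈2 delete0 B
  covered-by-cases y (no y≢0)  = covered-nonzero y y≢0
  covered-by-cases y (yes y≡0) with some-element
  ... | w , w∈B′ = inj₂ (w , w , w∈B′ , w∈B′ , trans (⊕-self w) (sym y≡0))

  covered : ∀ y → y ∈ delete0 B ⊎ y ∈2 delete0 B
  covered y = covered-by-cases y (y ≟V 𝟘)

round-of-full-sumset : ∀ {r} (A : Subset r) → MinimalOneSaturating A →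
                       (∀ y → y ∈2 A) → Round A
round-of-full-sumset A ((0∉A , _) , minimal) full B B⊊A same =
  minimal B B⊊A (saturating-of-full-sumset B (λ 0∈B → 0∉A (proj₁ B⊊A 𝟘 0∈B))
                                             (λ y → proj₂ (same y) (full y)))

round-insert0-of-gap : ∀ r → r ≥ 1 → (A : Subset r) → MinimalOneSaturating A →
                       ¬ (∀ y → y ∈2 A) → Round (insert0 A)
round-insert0-of-gap r r≥1 A (satA , minimal) gap B (B⊆A₀ , z , z∈A₀ , z∉B) same
  with B 𝟘 in 0∈?B
... | false = gap λ y → ∈2-mono B⊆A (full y)
  where
  full : ∀ y → y ∈2 B
  full y = proj₂ (same y) (insert0-full-sumset A satA y)
  B⊆A : B ⊆ A
  B⊆A x x∈B = insert0-nonzero A x x≢0 (B⊆A₀ x x∈B)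
    where x≢0 : ¬ x ≡ 𝟘
          x≢0 x≡0 with trans (sym 0∈?B) (subst (_∈ B) x≡0 x∈B)
          ... | ()
... | true = minimal (delete0 B) (B′⊆A , z , z∈A , z∉B′) saturating
  where
  z≢0 : ¬ z ≡ 𝟘
  z≢0 z≡0 = z∉B (subst (_∈ B) (sym z≡0) 0∈?B)
  z∈A : z ∈ A
  z∈A = insert0-nonzero A z z≢0 z∈A₀
  z∉B′ : z ∉ delete0 B
  z∉B′ z∈B′ = z∉B (delete0-⊆ B z z∈B′)
  B′⊆A : delete0 B ⊆ A
  B′⊆A x x∈B′ = insert0-nonzero A x x≢0 (B⊆A₀ x (delete0-⊆ B x x∈B′))
    where x≢0 : ¬ x ≡ 𝟘
          x≢0 x≡0 = delete0-∌0 B (subst (_∈ delete0 B) x≡0 x∈B′)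
  saturating : OneSaturating (delete0 B)
  saturating = delete0-saturating r r≥1 B
    λ y _ → proj₂ (same y) (insert0-full-sumset A satA y)

lemma3p1 : (r : ℕ) → r ≥ 1 → (A : Subset r) →
           MinimalOneSaturating A → Round A ⊎ Round (insert0 A)
lemma3p1 r r≥1 A minA with full-sumset-dec A
... | yes full = inj₁ (round-of-full-sumset A minA full)
... | no gap   = inj₂ (round-insert0-of-gap r r≥1 A minA gap)
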